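{- Let $S$ be a c-monoid and $d(S)=\{x\in S\mid d(x)=x\}$. Then $1_\sigma\in d(S)$, $d(S)$ is closed under $\cdot$ and $\|$, for all $x,y\in d(S)$ one has $x\cdot y=x\|y$, and $(d(S),\cdot,1_\sigma)$ is a semilattice with unit, i.e. $\cdot$ restricted to $d(S)$ is associative, commutative and idempotent and $1_\sigma$ is its unit.
   Context: A proto-monoid is a structure $(S,\cdot,1_\sigma)$ with $1_\sigma\cdot x=x=x\cdot 1_\sigma$ for all $x$ (no associativity required). A proto-bi-monoid is $(S,\cdot,\|,1_\sigma,1_\pi)$ such that $(S,\cdot,1_\sigma)$ is a proto-monoid and $(S,\|,1_\pi)$ is a commutative monoid. A c-monoid is a proto-bi-monoid satisfying, for all $x,y$: (c1) $(x\cdot 1_\pi)\|x=x$; (c2) $((x\cdot 1_\pi)\|1_\sigma)\cdot y=(x\cdot 1_\pi)\|y$; (c3) $(x\|y)\cdot 1_\pi=(x\cdot 1_\pi)\|(y\cdot 1_\pi)$; (c4) $(x\cdot y)\cdot 1_\pi=x\cdot(y\cdot 1_\pi)$; (c5) $1_\sigma\|1_\sigma=1_\sigma$. The domain operation is defined by $d(x)=(x\cdot 1_\pi)\|1_\sigma$. -}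

module Defs where

open import Level using (Level; suc)
open import Relation.Binary.PropositionalEquality using (_≡_)

record CMonoid (c : Level) : Set (suc c) where
  infixl 7 _·_
  infixl 6 _∥_
  field
    Carrier : Set c
    _·_     : Carrier → Carrier → Carrier
    _∥_     : Carrier → Carrier → Carrier
    1σ      : Carrier
    1π      : Carrier
    ·-identityˡ : ∀ x → 1σ · x ≡ x
    ·-identityʳ : ∀ x → x · 1σ ≡ x
    ∥-assoc     : ∀ x y z → (x ∥ y) ∥ z ≡ x ∥ (y ∥ z)
    ∥-comm      : ∀ x y → x ∥ y ≡ y ∥ x
    ∥-identityˡ : ∀ x → 1π ∥ x ≡ x
    ∥-identityʳ : ∀ x → x ∥ 1π ≡ x
    c1 : ∀ x → (x · 1π) ∥ x ≡ x
    c2 : ∀ x y → ((x · 1π) ∥ 1σ) · y ≡ (x · 1π) ∥ y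
    c3 : ∀ x y → (x ∥ y) · 1π ≡ (x · 1π) ∥ (y · 1π)
    c4 : ∀ x y → (x · y) · 1π ≡ x · (y · 1π)
    c5 : 1σ ∥ 1σ ≡ 1σ

  d : Carrier → Carrier
  d x = (x · 1π) ∥ 1σ

  InD : Carrier → Set c
  InD x = d x ≡ x

-- By (c2), a domain element x acts on the left as x · y = (x · 1π) ∥ y, and (c5)
-- makes 1σ a unit for ∥ on d(S); together these turn x · y into x ∥ y on d(S).
-- Everything else is then inherited from the commutative monoid (S, ∥), with
-- idempotence being exactly (c1).
module Submission where

open import Defs
open import Level using (Level)
open import Data.Product using (_×_; _,_)
open import Relation.Binary.PropositionalEquality
  using (_≡_; sym; trans; cong; cong₂; subst; module ≡-Reasoning)

module DomainSemilattice {c : Level} (S : CMonoid c) where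
  open CMonoid S
  open ≡-Reasoning

  ∥-interchange : ∀ a b e f → (a ∥ b) ∥ (e ∥ f) ≡ (a ∥ e) ∥ (b ∥ f)
  ∥-interchange a b e f = begin
    (a ∥ b) ∥ (e ∥ f)  ≡⟨ ∥-assoc a b (e ∥ f) ⟩
    a ∥ (b ∥ (e ∥ f))  ≡⟨ cong (a ∥_) (sym (∥-assoc b e f)) ⟩
    a ∥ ((b ∥ e) ∥ f)  ≡⟨ cong (λ t → a ∥ (t ∥ f)) (∥-comm b e) ⟩
    a ∥ ((e ∥ b) ∥ f)  ≡⟨ cong (a ∥_) (∥-assoc e b f) ⟩
    a ∥ (e ∥ (b ∥ f))  ≡⟨ sym (∥-assoc a e (b ∥ f)) ⟩
    (a ∥ e) ∥ (b ∥ f)  ∎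

  InD-1σ : InD 1σ
  InD-1σ = trans (cong (_∥ 1σ) (·-identityˡ 1π)) (∥-identityˡ 1σ)

  InD-∥ : ∀ x y → InD x → InD y → InD (x ∥ y)
  InD-∥ x y dx dy = begin
    ((x ∥ y) · 1π) ∥ 1σ                ≡⟨ cong (_∥ 1σ) (c3 x y) ⟩
    ((x · 1π) ∥ (y · 1π)) ∥ 1σ         ≡⟨ cong (((x · 1π) ∥ (y · 1π)) ∥_) (sym c5) ⟩
    ((x · 1π) ∥ (y · 1π)) ∥ (1σ ∥ 1σ)  ≡⟨ ∥-interchange (x · 1π) (y · 1π) 1σ 1σ ⟩
    ((x · 1π) ∥ 1σ) ∥ ((y · 1π) ∥ 1σ)  ≡⟨ cong₂ _∥_ dx dy ⟩
    x ∥ y                              ∎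

  ·-InD-left : ∀ x y → InD x → x · y ≡ (x · 1π) ∥ y
  ·-InD-left x y dx = trans (cong (_· y) (sym dx)) (c2 x y)

  ∥-identityˡ-InD : ∀ y → InD y → 1σ ∥ y ≡ y
  ∥-identityˡ-InD y dy = begin
    1σ ∥ y                      ≡⟨ cong (1σ ∥_) (sym dy) ⟩
    1σ ∥ ((y · 1π) ∥ 1σ)        ≡⟨ ∥-comm 1σ ((y · 1π) ∥ 1σ) ⟩
    ((y · 1π) ∥ 1σ) ∥ 1σ        ≡⟨ ∥-assoc (y · 1π) 1σ 1σ ⟩
    (y · 1π) ∥ (1σ ∥ 1σ)        ≡⟨ cong ((y · 1π) ∥_) c5 ⟩
    (y · 1π) ∥ 1σ               ≡⟨ dy ⟩
    y                           ∎

  ·≡∥-InD : ∀ x y → InD x → InD y → x · y ≡ x ∥ y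
  ·≡∥-InD x y dx dy = begin
    x · y                ≡⟨ ·-InD-left x y dx ⟩
    (x · 1π) ∥ y         ≡⟨ cong ((x · 1π) ∥_) (sym (∥-identityˡ-InD y dy)) ⟩
    (x · 1π) ∥ (1σ ∥ y)  ≡⟨ sym (∥-assoc (x · 1π) 1σ y) ⟩
    ((x · 1π) ∥ 1σ) ∥ y  ≡⟨ cong (_∥ y) dx ⟩
    x ∥ y                ∎

  InD-· : ∀ x y → InD x → InD y → InD (x · y)
  InD-· x y dx dy = subst InD (sym (·≡∥-InD x y dx dy)) (InD-∥ x y dx dy)

  ·-assoc-InD : ∀ x y z → InD x → InD y → InD z → (x · y) · z ≡ x · (y · z)
  ·-assoc-InD x y z dx dy dz = begin
    (x · y) · z  ≡⟨ ·≡∥-InD (x · y) z (InD-· x y dx dy) dz ⟩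
    (x · y) ∥ z  ≡⟨ cong (_∥ z) (·≡∥-InD x y dx dy) ⟩
    (x ∥ y) ∥ z  ≡⟨ ∥-assoc x y z ⟩
    x ∥ (y ∥ z)  ≡⟨ cong (x ∥_) (sym (·≡∥-InD y z dy dz)) ⟩
    x ∥ (y · z)  ≡⟨ sym (·≡∥-InD x (y · z) dx (InD-· y z dy dz)) ⟩
    x · (y · z)  ∎

  ·-comm-InD : ∀ x y → InD x → InD y → x · y ≡ y · x
  ·-comm-InD x y dx dy = begin
    x · y  ≡⟨ ·≡∥-InD x y dx dy ⟩
    x ∥ y  ≡⟨ ∥-comm x y ⟩
    y ∥ x  ≡⟨ sym (·≡∥-InD y x dy dx) ⟩
    y · x  ∎

  ·-idem-InD : ∀ x → InD x → x · x ≡ x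
  ·-idem-InD x dx = trans (·-InD-left x x dx) (c1 x)

proposition10 : ∀ {c : Level} (S : CMonoid c) → let open CMonoid S in
    InD 1σ
    × (∀ x y → InD x → InD y → InD (x · y))
    × (∀ x y → InD x → InD y → InD (x ∥ y))
    × (∀ x y → InD x → InD y → x · y ≡ x ∥ y)
    × (∀ x y z → InD x → InD y → InD z → (x · y) · z ≡ x · (y · z))
    × (∀ x y → InD x → InD y → x · y ≡ y · x)
    × (∀ x → InD x → x · x ≡ x)
    × (∀ x → InD x → 1σ · x ≡ x × x · 1σ ≡ x)
proposition10 S =
    InD-1σ , InD-· , InD-∥ , ·≡∥-InD , ·-assoc-InD , ·-comm-InD , ·-idem-InD
  , λ x _ → ·-identityˡ x , ·-identityʳ x
  where
    open CMonoid S
    open DomainSemilattice S
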